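{- Let $B$ be a directed bipartite graph with vertex parts $L$ and $R$ in which every edge is oriented from $L$ to $R$, let $\mathcal{D}(B)$ be the directed multi-graph constructed from $B$ as described in the context, and let $H$ be the undirected multi-graph obtained from $\mathcal{D}(B)$ by replacing every directed edge by an undirected edge, with Steiner set $S=\{s,t\}$. For $u\in L$ and $v\in R$: upon failure of edges $(s,u)$ and $(v,t)$ in $H$, the capacity of an $S$-mincut of $H$ decreases by $1$ if and only if $(u,v)$ is an edge of $B$; and upon insertion of edges $(s,v)$ and $(u,t)$ into $H$, the capacity of an $S$-mincut of $H$ increases by $1$ if and only if $(u,v)$ is an edge of $B$.
   Context: Construction of $\mathcal{D}(B)$: vertex set $L\cup R\cup\{s,t\}$; include every edge of $B$; for each $u\in L$ with $p>0$ outgoing edges in $B$ add $p$ edges from $s$ to $u$; for each $u\in R$ with $p>0$ incoming edges in $B$ add $p$ edges from $u$ to $t$; additionally for each $u\in L\cup R$ add one edge from $s$ to $u$ and one from $u$ to $t$. In the undirected graph $H$, an $S$-mincut is a set $C$ with $s\in C$, $t\notin C$ (or vice versa) minimizing the number of edges with exactly one endpoint in $C$. Failure of an edge removes one copy of it. -}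

module Defs where

open import Data.Nat using (ℕ; zero; suc; _+_; _⊓_)
open import Data.Bool using (Bool; true; false; _xor_; if_then_else_)
open import Data.Fin using (Fin)
open import Data.Fin.Properties using () renaming (_≟_ to _≟F_)
open import Data.Vec using (Vec; []; _∷_; lookup)
open import Data.List using (List; []; _∷_; _++_; map; concatMap; allFin; replicate; length)
open import Data.Product using (_×_; _,_)
open import Relation.Nullary using (does)

-- A directed bipartite graph B with parts L = Fin m, R = Fin n, all edges
-- oriented L → R:  B u v ≡ true  iff  (u , v) is an edge of B.
BipGraph : ℕ → ℕ → Set
BipGraph m n = Fin m → Fin n → Bool

data V (m n : ℕ) : Set where
  src tgt : V m n
  left  : Fin m → V m n
  right : Fin n → V m n

_==V_ : ∀ {m n} → V m n → V m n → Bool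
src     ==V src     = true
tgt     ==V tgt     = true
left a  ==V left b  = does (a ≟F b)
right a ==V right b = does (a ≟F b)
_       ==V _       = false

-- A multigraph is a list of edges (with multiplicity); for the undirected
-- graph H an edge (a , b) stands for the unordered pair {a , b}.
MultiGraph : ℕ → ℕ → Set
MultiGraph m n = List (V m n × V m n)

count : {A : Set} → (A → Bool) → List A → ℕ
count p []       = 0
count p (x ∷ xs) = if p x then suc (count p xs) else count p xs

outdeg : ∀ {m n} → BipGraph m n → Fin m → ℕ
outdeg {n = n} B u = count (λ v → B u v) (allFin n)

indeg : ∀ {m n} → BipGraph m n → Fin n → ℕ
indeg {m = m} B v = count (λ u → B u v) (allFin m)

-- The edge list of 𝒟(B) (and of H, reading each edge as undirected).
𝒟 : ∀ {m n} → BipGraph m n → MultiGraph m n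
𝒟 {m} {n} B =
     concatMap (λ u → concatMap (λ v → if B u v then (left u , right v) ∷ [] else [])
                                (allFin n)) (allFin m)
  ++ concatMap (λ u → replicate (outdeg B u) (src , left u)) (allFin m)
  ++ concatMap (λ v → replicate (indeg B v) (right v , tgt)) (allFin n)
  ++ concatMap (λ u → (src , left u) ∷ (left u , tgt) ∷ []) (allFin m)
  ++ concatMap (λ v → (src , right v) ∷ (right v , tgt) ∷ []) (allFin n)

fail : ∀ {m n} → V m n → V m n → MultiGraph m n → MultiGraph m n
fail a b [] = []
fail a b ((x , y) ∷ es) =
  if ((x ==V a) Data.Bool.∧ (y ==V b)) Data.Bool.∨ ((x ==V b) Data.Bool.∧ (y ==V a))
  then es else (x , y) ∷ fail a b es

insert : ∀ {m n} → V m n → V m n → MultiGraph m n → MultiGraph m n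
insert a b es = (a , b) ∷ es

-- A set C ⊆ V with s ∈ C and t ∉ C, given by its characteristic vectors on L and R.
Cut : ℕ → ℕ → Set
Cut m n = Vec Bool m × Vec Bool n

inC : ∀ {m n} → Cut m n → V m n → Bool
inC C src = true
inC C tgt = false
inC (x , y) (left a)  = lookup x a
inC (x , y) (right b) = lookup y b

capacity : ∀ {m n} → MultiGraph m n → Cut m n → ℕ
capacity H C = count (λ { (a , b) → inC C a xor inC C b }) H

allVecs : (k : ℕ) → List (Vec Bool k)
allVecs zero    = [] ∷ []
allVecs (suc k) = concatMap (λ xs → (false ∷ xs) ∷ (true ∷ xs) ∷ []) (allVecs k)

allCuts : (m n : ℕ) → List (Cut m n)
allCuts m n = concatMap (λ x → map (λ y → (x , y)) (allVecs n)) (allVecs m)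

minimum : ℕ → List ℕ → ℕ
minimum d []       = d
minimum d (x ∷ []) = x
minimum d (x ∷ xs@(_ ∷ _)) = x ⊓ minimum d xs

mincut : ∀ {m n} → MultiGraph m n → ℕ
mincut {m} {n} H = minimum 0 (map (capacity H) (allCuts m n))

module Submission where

-- A cut C (with s ∈ C ∌ t) cuts exactly one of the edges s–w, w–t for every vertex w, and of the
-- three edges u–v, s–u, v–t that an arc (u, v) of B contributes to 𝒟(B) it cuts exactly one, or all
-- three when u ∉ C ∋ v. So the capacity of C is |L| + |R| + |B| plus twice the number of arcs of B
-- entering C, and C = V ∖ {t} is an S-mincut. Failing s–u and v–t lowers the capacity of V ∖ {t} by
-- one, and lowers that of any cut by two only if u ∉ C ∋ v, which costs two extra when (u, v) ∈ B.
-- Inserting s–v and u–t raises the capacity of every cut by at least one unless u ∉ C ∋ v. When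
-- (u, v) ∉ B, the cut {s, v} ∪ L ∖ {u} is an S-mincut of 𝒟(B) cut by both failed edges and by
-- neither inserted edge.

open import Defs
open import Data.Bool using (Bool; true; false; not; _∧_; _∨_; _xor_; if_then_else_; T)
open import Data.Bool.Properties using (T-∧; T-∨; T-≡; xor-comm; ∧-zeroʳ; ¬-not)
open import Data.Empty using (⊥-elim)
open import Data.Fin using (Fin; zero; suc)
open import Data.Fin.Properties using (_≟_)
open import Data.List using (List; []; _∷_; _++_; concatMap; allFin; replicate; tabulate)
open import Data.List.Membership.Propositional using (_∈_; lose)
open import Data.List.Membership.Propositional.Properties
  using (∈-++⁺ˡ; ∈-++⁺ʳ; ∈-map⁺; ∈-map⁻; ∈-concatMap⁺; ∈-allFin)
open import Data.List.Relation.Unary.Any using (here; there)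
open import Data.Nat using (ℕ; zero; suc; _+_; _*_; _≤_; z≤n)
open import Data.Nat.Properties
  using (≤-refl; ≤-trans; ≤-antisym; ≤-reflexive; module ≤-Reasoning; <⇒≢; n<1+n; m≤m+n;
         +-comm; +-assoc; +-identityʳ; +-monoˡ-≤; +-monoʳ-≤; +-monoʳ-<; +-cancelʳ-≤; *-monoʳ-≤;
         ⊓-sel; m⊓n≤m; m⊓n≤n; +-*-semiring)
open import Algebra.Properties.Semiring.Sum +-*-semiring
  using (sum; sum-syntax; ∑-distrib-+; ∑-comm; sum-cong-≗; sum-replicate-zero; sum-remove;
         *-distribˡ-sum; *-distribʳ-sum)
open import Data.Product using (_×_; _,_; ∃-syntax)
open import Data.Sum using (_⊎_; inj₁; inj₂; [_,_]′)
open import Data.Vec as Vec using (Vec; []; _∷_; lookup)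
open import Data.Vec.Properties using (lookup-replicate; lookup∘tabulate)
open import Data.Vec.Functional using (Vector)
open import Function using (_∘_; id)
open import Function.Bundles using (_⇔_; mk⇔; Equivalence)
open import Relation.Nullary using (does; yes; no)
open import Relation.Nullary.Decidable using (dec-true)
open import Relation.Binary.PropositionalEquality

open Equivalence using (to; from)

private
  variable
    A X : Set
    m n k : ℕ

⟦_⟧ : Bool → ℕ
⟦ b ⟧ = if b then 1 else 0

count-∷ : (p : A → Bool) (x : A) (xs : List A) → count p (x ∷ xs) ≡ ⟦ p x ⟧ + count p xs
count-∷ p x xs with p x
... | true  = refl
... | false = refl

count-++ : (p : A → Bool) (xs ys : List A) → count p (xs ++ ys) ≡ count p xs + count p ys
count-++ p []       ys = refl
count-++ p (x ∷ xs) ys with p x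
... | true  = cong suc (count-++ p xs ys)
... | false = count-++ p xs ys

count-if : (p : A → Bool) (b : Bool) (x : A) → count p (if b then x ∷ [] else []) ≡ ⟦ b ∧ p x ⟧
count-if p true  x = refl
count-if p false x = refl

count-replicate : (p : A → Bool) (k : ℕ) (x : A) → count p (replicate k x) ≡ k * ⟦ p x ⟧
count-replicate p zero    x = refl
count-replicate p (suc k) x = trans (count-∷ p x (replicate k x)) (cong (⟦ p x ⟧ +_) (count-replicate p k x))

count-tabulate : (p : A → Bool) (g : Fin k → A) → count p (tabulate g) ≡ ∑[ i < k ] ⟦ p (g i) ⟧
count-tabulate {k = zero}  p g = refl
count-tabulate {k = suc k} p g =
  trans (count-∷ p (g zero) (tabulate (g ∘ suc))) (cong (⟦ p (g zero) ⟧ +_) (count-tabulate p (g ∘ suc)))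

count-concatMap-tabulate : (p : X → Bool) (f : A → List X) (g : Fin k → A) →
  count p (concatMap f (tabulate g)) ≡ ∑[ i < k ] count p (f (g i))
count-concatMap-tabulate {k = zero}  p f g = refl
count-concatMap-tabulate {k = suc k} p f g =
  trans (count-++ p (f (g zero)) _) (cong (count p (f (g zero)) +_) (count-concatMap-tabulate p f (g ∘ suc)))

∑-1 : ∑[ i < k ] 1 ≡ k
∑-1 {zero}  = refl
∑-1 {suc k} = cong suc (∑-1 {k})

term≤∑ : (f : Vector ℕ k) (i : Fin k) → f i ≤ sum f
term≤∑ {suc k} f i = ≤-trans (m≤m+n (f i) _) (≤-reflexive (sym (sum-remove {i = i} f)))

∑² : (Fin m → Fin n → ℕ) → ℕ
∑² {m} {n} f = ∑[ i < m ] ∑[ j < n ] f i j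

∑²-cong : (f g : Fin m → Fin n → ℕ) → (∀ i j → f i j ≡ g i j) → ∑² f ≡ ∑² g
∑²-cong f g f≗g = sum-cong-≗ (λ i → sum-cong-≗ (f≗g i))

∑²-distrib-+ : (f g : Fin m → Fin n → ℕ) → ∑² (λ i j → f i j + g i j) ≡ ∑² f + ∑² g
∑²-distrib-+ f g =
  trans (sum-cong-≗ (λ i → ∑-distrib-+ (f i) (g i))) (∑-distrib-+ (λ i → sum (f i)) (λ i → sum (g i)))

*-distribˡ-∑² : (c : ℕ) (f : Fin m → Fin n → ℕ) → c * ∑² f ≡ ∑² (λ i j → c * f i j)
*-distribˡ-∑² c f = trans (*-distribˡ-sum c (λ i → sum (f i))) (sum-cong-≗ (λ i → *-distribˡ-sum c (f i)))

∑²-zero : (f : Fin m → Fin n → ℕ) → (∀ i j → f i j ≡ 0) → ∑² f ≡ 0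
∑²-zero {m} {n} f f≗0 =
  trans (∑²-cong f (λ _ _ → 0) f≗0) (trans (sum-cong-≗ {m} (λ i → sum-replicate-zero n)) (sum-replicate-zero m))

term≤∑² : (f : Fin m → Fin n → ℕ) (i : Fin m) (j : Fin n) → f i j ≤ ∑² f
term≤∑² f i j = ≤-trans (term≤∑ (f i) j) (term≤∑ (λ i → sum (f i)) i)

minimum-≤ : (d : ℕ) {x : ℕ} {xs : List ℕ} → x ∈ xs → minimum d xs ≤ x
minimum-≤ d {xs = _ ∷ []}    (here refl) = ≤-refl
minimum-≤ d {xs = _ ∷ _ ∷ _} (here refl) = m⊓n≤m _ _
minimum-≤ d {xs = _ ∷ _ ∷ _} (there x∈) = ≤-trans (m⊓n≤n _ _) (minimum-≤ d x∈)

-- The hypothesis x ∈ xs only excludes xs = [], whose minimum is the junk value d.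
minimum-∈ : (d : ℕ) {x : ℕ} {xs : List ℕ} → x ∈ xs → minimum d xs ∈ xs
minimum-∈ d {xs = _ ∷ []}     _ = here refl
minimum-∈ d {xs = y ∷ z ∷ zs} _ =
  [ here
  , (λ y⊓min≡min → there (subst (_∈ z ∷ zs) (sym y⊓min≡min) (minimum-∈ d {xs = z ∷ zs} (here refl))))
  ]′ (⊓-sel y (minimum d (z ∷ zs)))

∈-allVecs : (xs : Vec Bool k) → xs ∈ allVecs k
∈-allVecs []           = here refl
∈-allVecs (false ∷ xs) = ∈-concatMap⁺ _ (lose (∈-allVecs xs) (here refl))
∈-allVecs (true ∷ xs)  = ∈-concatMap⁺ _ (lose (∈-allVecs xs) (there (here refl)))

∈-allCuts : (C : Cut m n) → C ∈ allCuts m n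
∈-allCuts (X , Y) = ∈-concatMap⁺ _ (lose (∈-allVecs X) (∈-map⁺ (X ,_) (∈-allVecs Y)))

mincut-≤ : (H : MultiGraph m n) (C : Cut m n) → mincut H ≤ capacity H C
mincut-≤ H C = minimum-≤ 0 (∈-map⁺ (capacity H) (∈-allCuts C))

isolating-t : Cut m n
isolating-t {m} {n} = Vec.replicate m true , Vec.replicate n true

mincut-attained : (H : MultiGraph m n) → ∃[ C ] mincut H ≡ capacity H C
mincut-attained {m} {n} H =
  let C , _ , min≡ = ∈-map⁻ (capacity H) (minimum-∈ 0 (∈-map⁺ (capacity H) (∈-allCuts (isolating-t {m} {n}))))
  in C , min≡

mincut-minimal : (H : MultiGraph m n) (C : Cut m n) →
  (∀ C′ → capacity H C ≤ capacity H C′) → mincut H ≡ capacity H C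
mincut-minimal H C C-minimal with mincut-attained H
... | C′ , min≡ = ≤-antisym (mincut-≤ H C) (subst (capacity H C ≤_) (sym min≡) (C-minimal C′))

==V-sound : {x y : V m n} → T (x ==V y) → x ≡ y
==V-sound {x = src}     {src}     _ = refl
==V-sound {x = tgt}     {tgt}     _ = refl
==V-sound {x = left i}  {left j}  i≟j with i ≟ j
... | yes i≡j = cong left i≡j
... | no _    = ⊥-elim i≟j
==V-sound {x = right i} {right j} i≟j with i ≟ j
... | yes i≡j = cong right i≡j
... | no _    = ⊥-elim i≟j
==V-sound {x = src}     {tgt}     ()
==V-sound {x = src}     {left _}  ()
==V-sound {x = src}     {right _} ()
==V-sound {x = tgt}     {src}     ()
==V-sound {x = tgt}     {left _}  ()
==V-sound {x = tgt}     {right _} ()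
==V-sound {x = left _}  {src}     ()
==V-sound {x = left _}  {tgt}     ()
==V-sound {x = left _}  {right _} ()
==V-sound {x = right _} {src}     ()
==V-sound {x = right _} {tgt}     ()
==V-sound {x = right _} {left _}  ()

==V-refl : (x : V m n) → T (x ==V x)
==V-refl src       = _
==V-refl tgt       = _
==V-refl (left i)  = from T-≡ (dec-true (i ≟ i) refl)
==V-refl (right i) = from T-≡ (dec-true (i ≟ i) refl)

matches : V m n → V m n → V m n × V m n → Bool
matches a b (x , y) = (x ==V a ∧ y ==V b) ∨ (x ==V b ∧ y ==V a)

matches-refl : (a b : V m n) → T (matches a b (a , b))
matches-refl a b = from T-∨ (inj₁ (from T-∧ (==V-refl a , ==V-refl b)))

matches-sound : {a b x y : V m n} → T (matches a b (x , y)) → (x , y) ≡ (a , b) ⊎ (x , y) ≡ (b , a)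
matches-sound {a = a} {b} {x} {y} ab~xy with to (T-∨ {x ==V a ∧ y ==V b}) ab~xy
... | inj₁ xa∧yb = let x≡a , y≡b = to (T-∧ {x ==V a}) xa∧yb
                   in inj₁ (cong₂ _,_ (==V-sound x≡a) (==V-sound y≡b))
... | inj₂ xb∧ya = let x≡b , y≡a = to (T-∧ {x ==V b}) xb∧ya
                   in inj₂ (cong₂ _,_ (==V-sound x≡b) (==V-sound y≡a))

crosses : Cut m n → V m n × V m n → Bool
crosses C (a , b) = inC C a xor inC C b

crosses-matches : (C : Cut m n) {a b : V m n} (e : V m n × V m n) →
  T (matches a b e) → crosses C e ≡ crosses C (a , b)
crosses-matches C {a} {b} (x , y) ab~xy with matches-sound {x = x} {y} ab~xy
... | inj₁ refl = refl
... | inj₂ refl = xor-comm (inC C b) (inC C a)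

∈-fail : {a b : V m n} {e : V m n × V m n} (H : MultiGraph m n) →
  e ∈ H → matches a b e ≡ false → e ∈ fail a b H
∈-fail (e ∷ H) (here refl) e≁ab rewrite e≁ab = here refl
∈-fail {a = a} {b} (e ∷ H) (there e∈H) e≁ab with matches a b e
... | true  = e∈H
... | false = there (∈-fail H e∈H e≁ab)

capacity-fail : {a b : V m n} (H : MultiGraph m n) (C : Cut m n) → (a , b) ∈ H →
  capacity (fail a b H) C + ⟦ crosses C (a , b) ⟧ ≡ capacity H C
capacity-fail {a = a} {b} (e ∷ H) C _ with matches a b e in e~ab
... | true  = begin
  capacity H C + ⟦ crosses C (a , b) ⟧ ≡⟨ cong (λ c → capacity H C + ⟦ c ⟧) (crosses-matches C e (from T-≡ e~ab)) ⟨
  capacity H C + ⟦ crosses C e ⟧       ≡⟨ +-comm (capacity H C) _ ⟩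
  ⟦ crosses C e ⟧ + capacity H C       ≡⟨ count-∷ (crosses C) e H ⟨
  capacity (e ∷ H) C                   ∎
  where open ≡-Reasoning
capacity-fail {a = a} {b} (e ∷ H) C (here refl) | false = ⊥-elim (subst T e~ab (matches-refl a b))
capacity-fail {a = a} {b} (e ∷ H) C (there ab∈) | false = begin
  capacity (e ∷ fail a b H) C + δ               ≡⟨ cong (_+ δ) (count-∷ (crosses C) e (fail a b H)) ⟩
  ⟦ crosses C e ⟧ + capacity (fail a b H) C + δ ≡⟨ +-assoc ⟦ crosses C e ⟧ _ δ ⟩
  ⟦ crosses C e ⟧ + (capacity (fail a b H) C + δ) ≡⟨ cong (⟦ crosses C e ⟧ +_) (capacity-fail H C ab∈) ⟩
  ⟦ crosses C e ⟧ + capacity H C                ≡⟨ count-∷ (crosses C) e H ⟨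
  capacity (e ∷ H) C                            ∎
  where
  open ≡-Reasoning
  δ : ℕ
  δ = ⟦ crosses C (a , b) ⟧

edges : BipGraph m n → ℕ
edges B = ∑² λ u v → ⟦ B u v ⟧

entering : BipGraph m n → Cut m n → ℕ
entering B (X , Y) = ∑² λ u v → ⟦ B u v ∧ not (lookup X u) ∧ lookup Y v ⟧

paths : (Fin k → V m n) → MultiGraph m n
paths {k} w = concatMap (λ i → (src , w i) ∷ (w i , tgt) ∷ []) (allFin k)

s-w∈paths : (w : Fin k → V m n) (i : Fin k) → (src , w i) ∈ paths w
s-w∈paths w i = ∈-concatMap⁺ _ (lose (∈-allFin i) (here refl))

w-t∈paths : (w : Fin k → V m n) (i : Fin k) → (w i , tgt) ∈ paths w
w-t∈paths w i = ∈-concatMap⁺ _ (lose (∈-allFin i) (there (here refl)))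

capacity-paths : (C : Cut m n) (w : Fin k → V m n) → capacity (paths w) C ≡ k
capacity-paths C w =
  trans (count-concatMap-tabulate (crosses C) (λ i → (src , w i) ∷ (w i , tgt) ∷ []) id)
        (trans (sum-cong-≗ λ i → one-cut (w i)) ∑-1)
  where
  one-cut : ∀ z → capacity ((src , z) ∷ (z , tgt) ∷ []) C ≡ 1
  one-cut z with inC C z
  ... | true  = refl
  ... | false = refl

arc-contribution : ∀ b x y →
  ⟦ b ∧ (x xor y) ⟧ + (⟦ b ⟧ * ⟦ not x ⟧ + ⟦ b ⟧ * ⟦ y xor false ⟧) ≡ ⟦ b ⟧ + 2 * ⟦ b ∧ not x ∧ y ⟧
arc-contribution false _     _     = refl
arc-contribution true  false false = refl
arc-contribution true  false true  = refl
arc-contribution true  true  false = refl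
arc-contribution true  true  true  = refl

module _ (B : BipGraph m n) where

  arc : Fin m → Fin n → MultiGraph m n
  arc u v = if B u v then (left u , right v) ∷ [] else []

  arcs sourceArcs sinkArcs : MultiGraph m n
  arcs       = concatMap (λ u → concatMap (arc u) (allFin n)) (allFin m)
  sourceArcs = concatMap (λ u → replicate (outdeg B u) (src , left u)) (allFin m)
  sinkArcs   = concatMap (λ v → replicate (indeg B v) (right v , tgt)) (allFin n)

  capacity-arcs : (C : Cut m n) → capacity arcs C ≡ ∑² λ u v → ⟦ B u v ∧ crosses C (left u , right v) ⟧
  capacity-arcs C = trans (count-concatMap-tabulate (crosses C) (λ u → concatMap (arc u) (allFin n)) id)
    (sum-cong-≗ λ u → trans (count-concatMap-tabulate (crosses C) (arc u) id)
                             (sum-cong-≗ λ v → count-if (crosses C) (B u v) (left u , right v)))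

  capacity-sourceArcs : (C : Cut m n) →
    capacity sourceArcs C ≡ ∑² λ u v → ⟦ B u v ⟧ * ⟦ crosses C (src , left u) ⟧
  capacity-sourceArcs C =
    trans (count-concatMap-tabulate (crosses C) (λ u → replicate (outdeg B u) (src , left u)) id)
    (sum-cong-≗ λ u → begin
      capacity (replicate (outdeg B u) (src , left u)) C
        ≡⟨ count-replicate (crosses C) (outdeg B u) (src , left u) ⟩
      outdeg B u * ⟦ crosses C (src , left u) ⟧
        ≡⟨ cong (_* ⟦ crosses C (src , left u) ⟧) (count-tabulate (B u) id) ⟩
      (∑[ v < n ] ⟦ B u v ⟧) * ⟦ crosses C (src , left u) ⟧
        ≡⟨ *-distribʳ-sum ⟦ crosses C (src , left u) ⟧ (λ v → ⟦ B u v ⟧) ⟩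
      ∑[ v < n ] (⟦ B u v ⟧ * ⟦ crosses C (src , left u) ⟧) ∎)
    where open ≡-Reasoning

  capacity-sinkArcs : (C : Cut m n) →
    capacity sinkArcs C ≡ ∑² λ u v → ⟦ B u v ⟧ * ⟦ crosses C (right v , tgt) ⟧
  capacity-sinkArcs C =
    trans (count-concatMap-tabulate (crosses C) (λ v → replicate (indeg B v) (right v , tgt)) id)
    (trans (sum-cong-≗ λ v → begin
      capacity (replicate (indeg B v) (right v , tgt)) C
        ≡⟨ count-replicate (crosses C) (indeg B v) (right v , tgt) ⟩
      indeg B v * ⟦ crosses C (right v , tgt) ⟧
        ≡⟨ cong (_* ⟦ crosses C (right v , tgt) ⟧) (count-tabulate (λ u → B u v) id) ⟩
      (∑[ u < m ] ⟦ B u v ⟧) * ⟦ crosses C (right v , tgt) ⟧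
        ≡⟨ *-distribʳ-sum ⟦ crosses C (right v , tgt) ⟧ (λ u → ⟦ B u v ⟧) ⟩
      ∑[ u < m ] (⟦ B u v ⟧ * ⟦ crosses C (right v , tgt) ⟧) ∎)
    (sym (∑-comm λ u v → ⟦ B u v ⟧ * ⟦ crosses C (right v , tgt) ⟧)))
    where open ≡-Reasoning

  capacity-blocks : (C : Cut m n) → capacity (𝒟 B) C ≡
    capacity arcs C + (capacity sourceArcs C + (capacity sinkArcs C + (capacity (paths left) C + capacity (paths right) C)))
  capacity-blocks C =
    trans (count-++ (crosses C) arcs _) (cong (capacity arcs C +_)
    (trans (count-++ (crosses C) sourceArcs _) (cong (capacity sourceArcs C +_)
    (trans (count-++ (crosses C) sinkArcs _) (cong (capacity sinkArcs C +_)
    (count-++ (crosses C) (paths left) (paths right)))))))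

  capacity-𝒟 : (C : Cut m n) → capacity (𝒟 B) C ≡ m + n + edges B + 2 * entering B C
  capacity-𝒟 C = begin
    capacity (𝒟 B) C
      ≡⟨ capacity-blocks C ⟩
    capacity arcs C + (capacity sourceArcs C + (capacity sinkArcs C + (capacity (paths left) C + capacity (paths right) C)))
      ≡⟨ cong₂ _+_ (capacity-arcs C) (cong₂ _+_ (capacity-sourceArcs C) (cong₂ _+_ (capacity-sinkArcs C)
                   (cong₂ _+_ (capacity-paths C left) (capacity-paths C right)))) ⟩
    ∑² t₁ + (∑² t₂ + (∑² t₃ + (m + n)))
      ≡⟨ trans (+-assoc (∑² t₁) (∑² t₂ + ∑² t₃) (m + n))
               (cong (∑² t₁ +_) (+-assoc (∑² t₂) (∑² t₃) (m + n))) ⟨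
    ∑² t₁ + (∑² t₂ + ∑² t₃) + (m + n)
      ≡⟨ cong (_+ (m + n)) (trans (∑²-distrib-+ t₁ _) (cong (∑² t₁ +_) (∑²-distrib-+ t₂ t₃))) ⟨
    ∑² (λ u v → t₁ u v + (t₂ u v + t₃ u v)) + (m + n)
      ≡⟨ cong (_+ (m + n)) (∑²-cong _ _ λ u v → arc-contribution (B u v) (inC C (left u)) (inC C (right v))) ⟩
    ∑² (λ u v → ⟦ B u v ⟧ + 2 * t₄ u v) + (m + n)
      ≡⟨ cong (_+ (m + n)) (trans (∑²-distrib-+ (λ u v → ⟦ B u v ⟧) (λ u v → 2 * t₄ u v))
                                  (cong (edges B +_) (sym (*-distribˡ-∑² 2 t₄)))) ⟩
    edges B + 2 * entering B C + (m + n)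
      ≡⟨ trans (+-comm _ (m + n)) (sym (+-assoc (m + n) _ _)) ⟩
    m + n + edges B + 2 * entering B C ∎
    where
    open ≡-Reasoning
    t₁ t₂ t₃ t₄ : Fin m → Fin n → ℕ
    t₁ u v = ⟦ B u v ∧ crosses C (left u , right v) ⟧
    t₂ u v = ⟦ B u v ⟧ * ⟦ crosses C (src , left u) ⟧
    t₃ u v = ⟦ B u v ⟧ * ⟦ crosses C (right v , tgt) ⟧
    t₄ u v = ⟦ B u v ∧ not (inC C (left u)) ∧ inC C (right v) ⟧

  entering≡0⇒capacity≡ : (C : Cut m n) → entering B C ≡ 0 → capacity (𝒟 B) C ≡ m + n + edges B
  entering≡0⇒capacity≡ C entering≡0 = begin
    capacity (𝒟 B) C                   ≡⟨ capacity-𝒟 C ⟩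
    m + n + edges B + 2 * entering B C ≡⟨ cong (λ κ → m + n + edges B + 2 * κ) entering≡0 ⟩
    m + n + edges B + 0                ≡⟨ +-identityʳ _ ⟩
    m + n + edges B                    ∎
    where open ≡-Reasoning

  entering-isolating-t : entering B isolating-t ≡ 0
  entering-isolating-t = ∑²-zero _ λ u v →
    trans (cong (λ a → ⟦ B u v ∧ not a ∧ lookup (Vec.replicate n true) v ⟧) (lookup-replicate u true))
          (cong ⟦_⟧ (∧-zeroʳ (B u v)))

  capacity-𝒟-isolating-t : capacity (𝒟 B) isolating-t ≡ m + n + edges B
  capacity-𝒟-isolating-t = entering≡0⇒capacity≡ isolating-t entering-isolating-t

  mincut-𝒟 : mincut (𝒟 B) ≡ m + n + edges B
  mincut-𝒟 = trans (mincut-minimal (𝒟 B) isolating-t isolating-t-minimal) capacity-𝒟-isolating-t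
    where
    isolating-t-minimal : ∀ C → capacity (𝒟 B) isolating-t ≤ capacity (𝒟 B) C
    isolating-t-minimal C = begin
      capacity (𝒟 B) isolating-t         ≡⟨ capacity-𝒟-isolating-t ⟩
      m + n + edges B                    ≤⟨ m≤m+n _ _ ⟩
      m + n + edges B + 2 * entering B C ≡⟨ capacity-𝒟 C ⟨
      capacity (𝒟 B) C                   ∎
      where open ≤-Reasoning

separating : Fin m → Fin n → Cut m n
separating u v = Vec.tabulate (λ u′ → not (does (u′ ≟ u))) , Vec.tabulate (λ v′ → does (v′ ≟ v))

separating-left : (u : Fin m) (v : Fin n) → inC (separating u v) (left u) ≡ false
separating-left u v = trans (lookup∘tabulate _ u) (cong not (dec-true (u ≟ u) refl))

separating-right : (u : Fin m) (v : Fin n) → inC (separating u v) (right v) ≡ true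
separating-right u v = trans (lookup∘tabulate _ v) (dec-true (v ≟ v) refl)

failure-bound : ∀ x y → ⟦ not x ⟧ + ⟦ y xor false ⟧ ≤ 1 + 2 * ⟦ not x ∧ y ⟧
failure-bound false false = ≤-refl
failure-bound false true  = m≤m+n 2 1
failure-bound true  false = z≤n
failure-bound true  true  = ≤-refl

insertion-bound : ∀ x y → 1 ≤ 2 * ⟦ not x ∧ y ⟧ + (⟦ not y ⟧ + ⟦ x xor false ⟧)
insertion-bound false false = ≤-refl
insertion-bound false true  = m≤m+n 1 1
insertion-bound true  false = m≤m+n 1 1
insertion-bound true  true  = ≤-refl

module _ (B : BipGraph m n) (u : Fin m) (v : Fin n) where

  failed inserted : MultiGraph m n
  failed   = fail src (left u) (fail (right v) tgt (𝒟 B))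
  inserted = insert src (right v) (insert (left u) tgt (𝒟 B))

  capacity-failed : (C : Cut m n) →
    capacity failed C + (⟦ crosses C (src , left u) ⟧ + ⟦ crosses C (right v , tgt) ⟧) ≡ capacity (𝒟 B) C
  capacity-failed C = begin
    capacity failed C + (⟦ crosses C (src , left u) ⟧ + ⟦ crosses C (right v , tgt) ⟧)
      ≡⟨ +-assoc (capacity failed C) _ _ ⟨
    capacity failed C + ⟦ crosses C (src , left u) ⟧ + ⟦ crosses C (right v , tgt) ⟧
      ≡⟨ cong (_+ ⟦ crosses C (right v , tgt) ⟧)
              (capacity-fail (fail (right v) tgt (𝒟 B)) C (∈-fail (𝒟 B) s-u∈𝒟 refl)) ⟩
    capacity (fail (right v) tgt (𝒟 B)) C + ⟦ crosses C (right v , tgt) ⟧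
      ≡⟨ capacity-fail (𝒟 B) C v-t∈𝒟 ⟩
    capacity (𝒟 B) C ∎
    where
    open ≡-Reasoning
    s-u∈𝒟 : (src , left u) ∈ 𝒟 B
    s-u∈𝒟 = ∈-++⁺ʳ (arcs B) (∈-++⁺ʳ (sourceArcs B) (∈-++⁺ʳ (sinkArcs B)
              (∈-++⁺ˡ (s-w∈paths left u))))
    v-t∈𝒟 : (right v , tgt) ∈ 𝒟 B
    v-t∈𝒟 = ∈-++⁺ʳ (arcs B) (∈-++⁺ʳ (sourceArcs B) (∈-++⁺ʳ (sinkArcs B)
              (∈-++⁺ʳ (paths left) (w-t∈paths right v))))

  capacity-inserted : (C : Cut m n) →
    capacity inserted C ≡ capacity (𝒟 B) C + (⟦ crosses C (src , right v) ⟧ + ⟦ crosses C (left u , tgt) ⟧)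
  capacity-inserted C = begin
    capacity inserted C
      ≡⟨ count-∷ (crosses C) (src , right v) (insert (left u) tgt (𝒟 B)) ⟩
    ⟦ crosses C (src , right v) ⟧ + capacity (insert (left u) tgt (𝒟 B)) C
      ≡⟨ cong (⟦ crosses C (src , right v) ⟧ +_) (count-∷ (crosses C) (left u , tgt) (𝒟 B)) ⟩
    ⟦ crosses C (src , right v) ⟧ + (⟦ crosses C (left u , tgt) ⟧ + capacity (𝒟 B) C)
      ≡⟨ trans (sym (+-assoc ⟦ crosses C (src , right v) ⟧ ⟦ crosses C (left u , tgt) ⟧ (capacity (𝒟 B) C)))
               (+-comm _ (capacity (𝒟 B) C)) ⟩
    capacity (𝒟 B) C + (⟦ crosses C (src , right v) ⟧ + ⟦ crosses C (left u , tgt) ⟧) ∎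
    where open ≡-Reasoning

  arc≤entering : (C : Cut m n) → B u v ≡ true → ⟦ not (inC C (left u)) ∧ inC C (right v) ⟧ ≤ entering B C
  arc≤entering (X , Y) uv∈B =
    subst (λ b → ⟦ b ∧ not (lookup X u) ∧ lookup Y v ⟧ ≤ entering B (X , Y)) uv∈B
          (term≤∑² (λ u′ v′ → ⟦ B u′ v′ ∧ not (lookup X u′) ∧ lookup Y v′ ⟧) u v)

  capacity-failed-isolating-t : capacity failed isolating-t + 1 ≡ m + n + edges B
  capacity-failed-isolating-t =
    trans (cong₂ (λ a b → capacity failed isolating-t + (⟦ not a ⟧ + ⟦ b xor false ⟧))
                 (sym (lookup-replicate u true)) (sym (lookup-replicate v true)))
          (trans (capacity-failed isolating-t) (capacity-𝒟-isolating-t B))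

  failed-lower-bound : B u v ≡ true → (C : Cut m n) → m + n + edges B ≤ capacity failed C + 1
  failed-lower-bound uv∈B C = +-cancelʳ-≤ (2 * entering B C) _ _ (begin
    m + n + edges B + 2 * entering B C
      ≡⟨ trans (capacity-failed C) (capacity-𝒟 B C) ⟨
    capacity failed C + (⟦ not x ⟧ + ⟦ y xor false ⟧)
      ≤⟨ +-monoʳ-≤ (capacity failed C) (failure-bound x y) ⟩
    capacity failed C + (1 + 2 * ⟦ not x ∧ y ⟧)
      ≤⟨ +-monoʳ-≤ (capacity failed C) (+-monoʳ-≤ 1 (*-monoʳ-≤ 2 (arc≤entering C uv∈B))) ⟩
    capacity failed C + (1 + 2 * entering B C)
      ≡⟨ +-assoc (capacity failed C) 1 _ ⟨
    capacity failed C + 1 + 2 * entering B C ∎)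
    where
    open ≤-Reasoning
    x y : Bool
    x = inC C (left u)
    y = inC C (right v)

  failure-with-edge : B u v ≡ true → mincut failed + 1 ≡ mincut (𝒟 B)
  failure-with-edge uv∈B = begin
    mincut failed + 1               ≡⟨ cong (_+ 1) (mincut-minimal failed isolating-t isolating-t-minimal) ⟩
    capacity failed isolating-t + 1 ≡⟨ capacity-failed-isolating-t ⟩
    m + n + edges B                 ≡⟨ mincut-𝒟 B ⟨
    mincut (𝒟 B)                    ∎
    where
    open ≡-Reasoning
    isolating-t-minimal : ∀ C → capacity failed isolating-t ≤ capacity failed C
    isolating-t-minimal C = +-cancelʳ-≤ 1 _ _
      (subst (_≤ capacity failed C + 1) (sym capacity-failed-isolating-t) (failed-lower-bound uv∈B C))

  capacity-inserted-isolating-t : capacity inserted isolating-t ≡ m + n + edges B + 1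
  capacity-inserted-isolating-t =
    trans (capacity-inserted isolating-t)
          (cong₂ _+_ (capacity-𝒟-isolating-t B)
                     (cong₂ (λ a b → ⟦ not b ⟧ + ⟦ a xor false ⟧)
                            (lookup-replicate u true) (lookup-replicate v true)))

  inserted-lower-bound : B u v ≡ true → (C : Cut m n) → m + n + edges B + 1 ≤ capacity inserted C
  inserted-lower-bound uv∈B C = begin
    m + n + edges B + 1
      ≤⟨ +-monoʳ-≤ (m + n + edges B) (insertion-bound x y) ⟩
    m + n + edges B + (2 * ⟦ not x ∧ y ⟧ + (⟦ not y ⟧ + ⟦ x xor false ⟧))
      ≤⟨ +-monoʳ-≤ (m + n + edges B) (+-monoˡ-≤ _ (*-monoʳ-≤ 2 (arc≤entering C uv∈B))) ⟩
    m + n + edges B + (2 * entering B C + (⟦ not y ⟧ + ⟦ x xor false ⟧))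
      ≡⟨ +-assoc (m + n + edges B) _ _ ⟨
    m + n + edges B + 2 * entering B C + (⟦ not y ⟧ + ⟦ x xor false ⟧)
      ≡⟨ trans (capacity-inserted C) (cong (_+ _) (capacity-𝒟 B C)) ⟨
    capacity inserted C ∎
    where
    open ≤-Reasoning
    x y : Bool
    x = inC C (left u)
    y = inC C (right v)

  insertion-with-edge : B u v ≡ true → mincut inserted ≡ mincut (𝒟 B) + 1
  insertion-with-edge uv∈B = begin
    mincut inserted               ≡⟨ mincut-minimal inserted isolating-t isolating-t-minimal ⟩
    capacity inserted isolating-t ≡⟨ capacity-inserted-isolating-t ⟩
    m + n + edges B + 1           ≡⟨ cong (_+ 1) (mincut-𝒟 B) ⟨
    mincut (𝒟 B) + 1              ∎
    where
    open ≡-Reasoning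
    isolating-t-minimal : ∀ C → capacity inserted isolating-t ≤ capacity inserted C
    isolating-t-minimal C =
      subst (_≤ capacity inserted C) (sym capacity-inserted-isolating-t) (inserted-lower-bound uv∈B C)

  entering-separating : B u v ≡ false → entering B (separating u v) ≡ 0
  entering-separating uv∉B = ∑²-zero _ term≡0
    where
    term≡0 : ∀ u′ v′ →
      ⟦ B u′ v′ ∧ not (inC (separating u v) (left u′)) ∧ inC (separating u v) (right v′) ⟧ ≡ 0
    term≡0 u′ v′ rewrite lookup∘tabulate (λ u″ → not (does (u″ ≟ u))) u′
                       | lookup∘tabulate (λ v″ → does (v″ ≟ v)) v′ with u′ ≟ u | v′ ≟ v
    ... | yes refl | yes refl rewrite uv∉B = refl
    ... | yes refl | no _     = cong ⟦_⟧ (∧-zeroʳ (B u v′))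
    ... | no _     | _        = cong ⟦_⟧ (∧-zeroʳ (B u′ v′))

  failure-without-edge : B u v ≡ false → mincut failed + 1 ≢ mincut (𝒟 B)
  failure-without-edge uv∉B = <⇒≢ (begin-strict
    mincut failed + 1       ≤⟨ +-monoˡ-≤ 1 (mincut-≤ failed S) ⟩
    capacity failed S + 1   <⟨ +-monoʳ-< (capacity failed S) (n<1+n 1) ⟩
    capacity failed S + 2   ≡⟨ cong₂ (λ a b → capacity failed S + (⟦ not a ⟧ + ⟦ b xor false ⟧))
                                      (separating-left u v) (separating-right u v) ⟨
    capacity failed S + (⟦ crosses S (src , left u) ⟧ + ⟦ crosses S (right v , tgt) ⟧)
                            ≡⟨ capacity-failed S ⟩
    capacity (𝒟 B) S       ≡⟨ entering≡0⇒capacity≡ B S (entering-separating uv∉B) ⟩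
    m + n + edges B         ≡⟨ mincut-𝒟 B ⟨
    mincut (𝒟 B)            ∎)
    where
    open ≤-Reasoning
    S : Cut m n
    S = separating u v

  insertion-without-edge : B u v ≡ false → mincut inserted ≢ mincut (𝒟 B) + 1
  insertion-without-edge uv∉B = <⇒≢ (begin-strict
    mincut inserted       ≤⟨ mincut-≤ inserted S ⟩
    capacity inserted S   ≡⟨ capacity-inserted S ⟩
    capacity (𝒟 B) S + (⟦ crosses S (src , right v) ⟧ + ⟦ crosses S (left u , tgt) ⟧)
                          ≡⟨ cong₂ (λ a b → capacity (𝒟 B) S + (⟦ not b ⟧ + ⟦ a xor false ⟧))
                                    (separating-left u v) (separating-right u v) ⟩
    capacity (𝒟 B) S + 0 ≡⟨ +-identityʳ _ ⟩
    capacity (𝒟 B) S     ≡⟨ entering≡0⇒capacity≡ B S (entering-separating uv∉B) ⟩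
    m + n + edges B       ≡⟨ mincut-𝒟 B ⟨
    mincut (𝒟 B)          <⟨ n<1+n _ ⟩
    suc (mincut (𝒟 B))    ≡⟨ +-comm 1 _ ⟩
    mincut (𝒟 B) + 1      ∎)
    where
    open ≤-Reasoning
    S : Cut m n
    S = separating u v

lemma109 : (m n : ℕ) (B : BipGraph m n) (u : Fin m) (v : Fin n) →
    ((mincut (fail src (left u) (fail (right v) tgt (𝒟 B))) + 1 ≡ mincut (𝒟 B))
      ⇔ (B u v ≡ true))
  × ((mincut (insert src (right v) (insert (left u) tgt (𝒟 B))) ≡ mincut (𝒟 B) + 1)
      ⇔ (B u v ≡ true))
lemma109 m n B u v =
    mk⇔ (λ drop → ¬-not λ uv∉B → failure-without-edge B u v uv∉B drop) (failure-with-edge B u v)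
  , mk⇔ (λ rise → ¬-not λ uv∉B → insertion-without-edge B u v uv∉B rise) (insertion-with-edge B u v)
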